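{- Let $p\ge 3$ and $0<r_1<p$ be coprime integers. Put $r_0=p$ and for $1\le i\le t$ define integers $Z_i$, $r_{i+1}$ by $r_{i-1}=Z_ir_i+r_{i+1}$, $0\le r_{i+1}<r_i$, where $t$ is the index with $r_t=1$ (so $r_{t+1}=0$). Let $\mathcal{Z}$ be the set of integer $t$-tuples $\mathbf z=(z_1,\dots,z_t)$ with $0\le z_i\le Z_i$ for all $i$, which are either $\mathbf 0=(0,\dots,0)$ or satisfy: (i) the smallest index $i$ with $z_i>0$ is odd, and (ii) $0\le z_t\le Z_t-1$. For $\mathbf z\in\mathcal{Z}$ put $R(\mathbf z)=\sum_{1\le i\le t}z_i(-1)^{i-1}r_i$. Then $R(\mathbf 0)=0$, and $0<R(\mathbf z)<p$ for every $\mathbf z\in\mathcal{Z}$ with $\mathbf z\ne\mathbf 0$. -}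

module Defs where

open import Data.Nat as ℕ using (ℕ; zero; suc; _≤_; _<_; _∸_; _+_)
open import Data.Integer as ℤ using (ℤ; +_; -1ℤ)
open import Data.Product using (∃; _×_)
open import Data.Sum using (_⊎_)
open import Relation.Binary.PropositionalEquality using (_≡_)

Odd : ℕ → Set
Odd i = ∃ λ k → i ≡ suc (2 ℕ.* k)

IsEuclid : ℕ → ℕ → (r Z : ℕ → ℕ) → ℕ → Set
IsEuclid p r₁ r Z t =
  (r 0 ≡ p) × (r 1 ≡ r₁) × (1 ≤ t) ×
  (∀ i → 1 ≤ i → i ≤ t → (r (i ∸ 1) ≡ Z i ℕ.* r i + r (suc i)) × (r (suc i) < r i)) ×
  (r t ≡ 1)

-- z is a tuple (z₁,…,z_t) (entries z i for 1 ≤ i ≤ t) with 0 ≤ z i ≤ Z i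
InBox : (Z : ℕ → ℕ) → ℕ → (z : ℕ → ℕ) → Set
InBox Z t z = ∀ i → 1 ≤ i → i ≤ t → z i ≤ Z i

Nonzero : ℕ → (z : ℕ → ℕ) → Set
Nonzero t z = ∃ λ i → (1 ≤ i) × (i ≤ t) × (0 < z i)

Conditions : (Z : ℕ → ℕ) → ℕ → (z : ℕ → ℕ) → Set
Conditions Z t z =
  (∀ i → 1 ≤ i → i ≤ t → 0 < z i → (∀ j → 1 ≤ j → j < i → z j ≡ 0) → Odd i) ×
  (z t ≤ Z t ∸ 1)

Zero : ℕ → (z : ℕ → ℕ) → Set
Zero t z = ∀ i → 1 ≤ i → i ≤ t → z i ≡ 0

In𝒵 : (Z : ℕ → ℕ) → ℕ → (z : ℕ → ℕ) → Set
In𝒵 Z t z = InBox Z t z × (Zero t z ⊎ Conditions Z t z)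


R : (r : ℕ → ℕ) → (z : ℕ → ℕ) → ℕ → ℤ
R r z zero = + 0
R r z (suc n) = R r z n ℤ.+ (+ z (suc n)) ℤ.* (-1ℤ ℤ.^ n) ℤ.* (+ r (suc n))

{-# OPTIONS --safe #-}
-- Read R(z) through its alternating tails A k = z k r k − z (k+1) r (k+1) + ⋯ ± z t r t.
-- From A t = z t < Z t = r (t−1) and r (k−1) = Z k r k + r (k+1) with z k ≤ Z k, downward
-- induction gives −r k < A k < r (k−1); hence R(z) = A 1 < r 0 = p. If the first nonzero digit
-- sits at an odd index m, the sign in front of it is +, so R(z) = A m = z m r m − A (m+1) > (z m − 1) r m ≥ 0.
module Submission where

open import Defs
open import Data.Nat using (ℕ; _≤_; _<_)
open import Data.Nat.Coprimality using (Coprime)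
open import Data.Integer as ℤ using (+_)
open import Data.Product using (_×_)
open import Relation.Binary.PropositionalEquality using (_≡_)

open import Data.Nat using (zero; suc; _+_; _*_; _∸_; z≤n; s≤s; z<s; >-nonZero)
import Data.Nat.Properties as ℕ
open import Data.Integer using (ℤ; -1ℤ; 1ℤ; +<+; +≤+)
import Data.Integer.Properties as ℤ
open import Data.Integer.Tactic.RingSolver using (solve-∀)
open import Data.Product using (∃-syntax; _,_; proj₁; proj₂)
open import Data.Sum using (inj₁; inj₂)
open import Function using (_∘_)
open import Relation.Binary.PropositionalEquality using (refl; sym; trans; cong; cong₂; subst; subst₂; module ≡-Reasoning)
open import Relation.Nullary using (contradiction)

altSum : (r z : ℕ → ℕ) → ℕ → ℕ → ℤ
altSum r z k zero    = + 0
altSum r z k (suc n) = + (z k * r k) ℤ.- altSum r z (suc k) n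

altSum-one : ∀ r z k → altSum r z k 1 ≡ + (z k * r k)
altSum-one r z k = ℤ.+-identityʳ (+ (z k * r k))

R-vanishing : ∀ r z n → (∀ i → 1 ≤ i → i ≤ n → z i ≡ 0) → R r z n ≡ + 0
R-vanishing r z zero    _   = refl
R-vanishing r z (suc n) z≡0 rewrite z≡0 (suc n) (s≤s z≤n) ℕ.≤-refl =
  trans (ℤ.+-identityʳ (R r z n)) (R-vanishing r z n (λ i 1≤i i≤n → z≡0 i 1≤i (ℕ.m≤n⇒m≤1+n i≤n)))

R-split : ∀ r z k n → R r z (k + n) ≡ R r z k ℤ.+ -1ℤ ℤ.^ k ℤ.* altSum r z (suc k) n
R-split r z k zero = begin
  R r z (k + 0)                  ≡⟨ cong (R r z) (ℕ.+-identityʳ k) ⟩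
  R r z k                        ≡⟨ ℤ.+-identityʳ (R r z k) ⟨
  R r z k ℤ.+ + 0                ≡⟨ cong (λ v → R r z k ℤ.+ v) (ℤ.*-zeroʳ (-1ℤ ℤ.^ k)) ⟨
  R r z k ℤ.+ -1ℤ ℤ.^ k ℤ.* + 0  ∎
  where open ≡-Reasoning
R-split r z k (suc n) = begin
  R r z (k + suc n)                               ≡⟨ cong (R r z) (ℕ.+-suc k n) ⟩
  R r z (suc k + n)                               ≡⟨ R-split r z (suc k) n ⟩
  R r z k ℤ.+ x ℤ.* s ℤ.* y ℤ.+ -1ℤ ℤ.* s ℤ.* u  ≡⟨ factor (R r z k) x y s u ⟩
  R r z k ℤ.+ s ℤ.* (x ℤ.* y ℤ.- u)              ≡⟨ cong (λ v → R r z k ℤ.+ s ℤ.* (v ℤ.- u)) (ℤ.pos-* (z (suc k)) (r (suc k))) ⟨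
  R r z k ℤ.+ s ℤ.* altSum r z (suc k) (suc n)   ∎
  where
  open ≡-Reasoning
  x = + z (suc k)
  y = + r (suc k)
  s = -1ℤ ℤ.^ k
  u = altSum r z (suc (suc k)) n
  factor : ∀ a x y s u → a ℤ.+ x ℤ.* s ℤ.* y ℤ.+ -1ℤ ℤ.* s ℤ.* u ≡ a ℤ.+ s ℤ.* (x ℤ.* y ℤ.- u)
  factor = solve-∀

i<j⇒0<j-i : ∀ {i j} → i ℤ.< j → + 0 ℤ.< j ℤ.- i
i<j⇒0<j-i {i} {j} i<j = subst (ℤ._< j ℤ.- i) (ℤ.+-inverseʳ i) (ℤ.+-monoˡ-< (ℤ.- i) i<j)

-1^[2*n]≡1 : ∀ n → -1ℤ ℤ.^ (2 * n) ≡ 1ℤ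
-1^[2*n]≡1 n = trans (sym (ℤ.^-*-assoc -1ℤ 2 n)) (ℤ.^-zeroˡ n)

R≡altSum : ∀ r z a n → (∀ i → 1 ≤ i → i ≤ 2 * a → z i ≡ 0) → R r z (2 * a + n) ≡ altSum r z (suc (2 * a)) n
R≡altSum r z a n z≡0 = begin
  R r z (2 * a + n)                          ≡⟨ R-split r z (2 * a) n ⟩
  R r z (2 * a) ℤ.+ -1ℤ ℤ.^ (2 * a) ℤ.* A    ≡⟨ cong₂ (λ b c → b ℤ.+ c ℤ.* A) (R-vanishing r z (2 * a) z≡0) (-1^[2*n]≡1 a) ⟩
  + 0 ℤ.+ 1ℤ ℤ.* A                           ≡⟨ ℤ.+-identityˡ (1ℤ ℤ.* A) ⟩
  1ℤ ℤ.* A                                   ≡⟨ ℤ.*-identityˡ A ⟩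
  A                                          ∎
  where
  open ≡-Reasoning
  A = altSum r z (suc (2 * a)) n

least-nonzero : ∀ (f : ℕ → ℕ) i → 0 < f i → ∃[ m ] m ≤ i × 0 < f m × (∀ j → j < m → f j ≡ 0)
least-nonzero f zero    0<f₀ = 0 , z≤n , 0<f₀ , λ _ ()
least-nonzero f (suc i) 0<fᵢ with f 0 in f₀≡
... | suc _ = 0 , z≤n , subst (0 <_) (sym f₀≡) z<s , λ _ ()
... | zero with least-nonzero (f ∘ suc) i 0<fᵢ
...   | m , m≤i , 0<fₘ , below = suc m , s≤s m≤i , 0<fₘ , vanish
  where
  vanish : ∀ j → j < suc m → f j ≡ 0
  vanish zero    _         = f₀≡
  vanish (suc j) (s≤s j<m) = below j j<m

remainders-decrease : ∀ {p r₁ r Z t} → r₁ < p → IsEuclid p r₁ r Z t → ∀ i → 1 ≤ i → i ≤ t → r i < r (i ∸ 1)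
remainders-decrease r₁<p (r₀≡p , r1≡r₁ , _) 1 _ _ = subst₂ _<_ (sym r1≡r₁) (sym r₀≡p) r₁<p
remainders-decrease _ (_ , _ , _ , euclid , _) (suc (suc i)) _ i<t =
  proj₂ (euclid (suc i) (s≤s z≤n) (ℕ.<⇒≤ i<t))

last-quotient : ∀ {p r₁ r Z t} → IsEuclid p r₁ r Z t → r (t ∸ 1) ≡ Z t
last-quotient {r = r} {Z} {t} (_ , _ , 1≤t , euclid , rₜ≡1) = begin
  r (t ∸ 1)              ≡⟨ proj₁ (euclid t 1≤t ℕ.≤-refl) ⟩
  Z t * r t + r (suc t)  ≡⟨ cong₂ (λ a b → Z t * a + b) rₜ≡1 rₜ₊₁≡0 ⟩
  Z t * 1 + 0            ≡⟨ ℕ.+-identityʳ (Z t * 1) ⟩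
  Z t * 1                ≡⟨ ℕ.*-identityʳ (Z t) ⟩
  Z t                    ∎
  where
  open ≡-Reasoning
  rₜ₊₁≡0 : r (suc t) ≡ 0
  rₜ₊₁≡0 = ℕ.n<1⇒n≡0 (subst (r (suc t) <_) rₜ≡1 (proj₂ (euclid t 1≤t ℕ.≤-refl)))

last-digit-bound : ∀ {p r₁ r Z t} {z : ℕ → ℕ} → r₁ < p → IsEuclid p r₁ r Z t → z t ≤ Z t ∸ 1 → z t * r t < r (t ∸ 1)
last-digit-bound {r = r} {Z} {t} {z} r₁<p E@(_ , _ , 1≤t , _ , rₜ≡1) zₜ≤Zₜ-1 = begin-strict
  z t * r t  ≡⟨ cong (z t *_) rₜ≡1 ⟩
  z t * 1    ≡⟨ ℕ.*-identityʳ (z t) ⟩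
  z t        ≤⟨ zₜ≤Zₜ-1 ⟩
  Z t ∸ 1    <⟨ ℕ.∸-monoʳ-< z<s 0<Zₜ ⟩
  Z t        ≡⟨ last-quotient {Z = Z} E ⟨
  r (t ∸ 1)  ∎
  where
  open ℕ.≤-Reasoning
  0<Zₜ : 0 < Z t
  0<Zₜ = subst (0 <_) (last-quotient {Z = Z} E) (ℕ.m<n⇒0<n (remainders-decrease {Z = Z} r₁<p E t 1≤t ℕ.≤-refl))

module EuclidDigits (r Z z : ℕ → ℕ) (t : ℕ)
  (euclid : ∀ i → 1 ≤ i → i ≤ t → r (i ∸ 1) ≡ Z i * r i + r (suc i))
  (z≤Z : InBox Z t z) (0<rₜ : 0 < r t) (zₜrₜ<rₜ₋₁ : z t * r t < r (t ∸ 1)) where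

  AltSumBounded : ℕ → ℕ → Set
  AltSumBounded k n = (ℤ.- + r k ℤ.< altSum r z k n) × (altSum r z k n ℤ.< + r (k ∸ 1))

  altSum-last-bounded : AltSumBounded t 1
  altSum-last-bounded rewrite altSum-one r z t =
    ℤ.<-≤-trans (ℤ.neg-mono-< (+<+ 0<rₜ)) (+≤+ z≤n) , +<+ zₜrₜ<rₜ₋₁

  altSum-bounded : ∀ n k → 1 ≤ k → k + n ≡ t → AltSumBounded k (suc n)
  altSum-bounded zero k _ k+0≡t =
    subst (λ i → AltSumBounded i 1) (sym (trans (sym (ℕ.+-identityʳ k)) k+0≡t)) altSum-last-bounded
  altSum-bounded (suc n) k 1≤k k+1+n≡t = lower , upper
    where
    open ℤ.≤-Reasoning
    k≤t : k ≤ t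
    k≤t = subst (k ≤_) k+1+n≡t (ℕ.m≤m+n k (suc n))
    T = altSum r z (suc k) (suc n)
    ih : AltSumBounded (suc k) (suc n)
    ih = altSum-bounded n (suc k) (s≤s z≤n) (trans (sym (ℕ.+-suc k n)) k+1+n≡t)
    lower : ℤ.- + r k ℤ.< + (z k * r k) ℤ.- T
    lower = begin-strict
      ℤ.- + r k            <⟨ ℤ.neg-mono-< (proj₂ ih) ⟩
      ℤ.- T                ≤⟨ ℤ.i≤j+i (ℤ.- T) (+ (z k * r k)) ⟩
      + (z k * r k) ℤ.- T  ∎
    upper : + (z k * r k) ℤ.- T ℤ.< + r (k ∸ 1)
    upper = begin-strict
      + (z k * r k) ℤ.- T               <⟨ ℤ.+-monoʳ-< (+ (z k * r k)) (ℤ.neg-mono-< (proj₁ ih)) ⟩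
      + (z k * r k) ℤ.- ℤ.- + r (suc k) ≡⟨ cong (λ v → + (z k * r k) ℤ.+ v) (ℤ.neg-involutive (+ r (suc k))) ⟩
      + (z k * r k) ℤ.+ + r (suc k)     ≡⟨ ℤ.pos-+ (z k * r k) (r (suc k)) ⟨
      + (z k * r k + r (suc k))         ≤⟨ +≤+ (ℕ.+-monoˡ-≤ (r (suc k)) (ℕ.*-monoˡ-≤ (r k) (z≤Z k 1≤k k≤t))) ⟩
      + (Z k * r k + r (suc k))         ≡⟨ cong +_ (euclid k 1≤k k≤t) ⟨
      + r (k ∸ 1)                       ∎

  altSum-positive : ∀ n k → 1 ≤ k → k + n ≡ t → 0 < z k → + 0 ℤ.< altSum r z k (suc n)
  altSum-positive n k 1≤k k+n≡t 0<zₖ = i<j⇒0<j-i (begin-strict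
    altSum r z (suc k) n  <⟨ next<rₖ n k+n≡t ⟩
    + r k                 ≤⟨ +≤+ (ℕ.m≤n*m (r k) (z k) {{>-nonZero 0<zₖ}}) ⟩
    + (z k * r k)         ∎)
    where
    open ℤ.≤-Reasoning
    next<rₖ : ∀ n → k + n ≡ t → altSum r z (suc k) n ℤ.< + r k
    next<rₖ zero    k+0≡t   = +<+ (subst (λ i → 0 < r i) (sym (trans (sym (ℕ.+-identityʳ k)) k+0≡t)) 0<rₜ)
    next<rₖ (suc n) k+1+n≡t = proj₂ (altSum-bounded n (suc k) (s≤s z≤n) (trans (sym (ℕ.+-suc k n)) k+1+n≡t))

  R<r₀ : 1 ≤ t → R r z t ℤ.< + r 0
  R<r₀ 1≤t = let n , 1+n≡t = ℕ.m≤n⇒∃[o]m+o≡n 1≤t in begin-strict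
    R r z t               ≡⟨ cong (R r z) 1+n≡t ⟨
    R r z (suc n)         ≡⟨ R≡altSum r z 0 (suc n) (λ { (suc _) _ () }) ⟩
    altSum r z 1 (suc n)  <⟨ proj₂ (altSum-bounded n 1 ℕ.≤-refl 1+n≡t) ⟩
    + r 0                 ∎
    where open ℤ.≤-Reasoning

  R-positive : (∀ i → 1 ≤ i → i ≤ t → 0 < z i → (∀ j → 1 ≤ j → j < i → z j ≡ 0) → Odd i) →
               Nonzero t z → + 0 ℤ.< R r z t
  R-positive first-odd (suc i , _ , i<t , 0<zᵢ) with least-nonzero (z ∘ suc) i 0<zᵢ
  ... | m , m≤i , 0<zₘ , below
    with first-odd (suc m) (s≤s z≤n) (ℕ.≤-trans (s≤s m≤i) i<t) 0<zₘ (λ { (suc j) _ (s≤s j<m) → below j j<m })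
  ...   | a , refl = let n , 2a+1+n≡t = ℕ.m≤n⇒∃[o]m+o≡n (ℕ.≤-trans (s≤s m≤i) i<t) in begin-strict
    + 0                               <⟨ altSum-positive n (suc (2 * a)) (s≤s z≤n) 2a+1+n≡t 0<zₘ ⟩
    altSum r z (suc (2 * a)) (suc n)  ≡⟨ R≡altSum r z a (suc n) (λ { (suc j) _ j<2a → below j j<2a }) ⟨
    R r z (2 * a + suc n)             ≡⟨ cong (R r z) (trans (ℕ.+-suc (2 * a) n) 2a+1+n≡t) ⟩
    R r z t                           ∎
    where open ℤ.≤-Reasoning

lemma3 : (p r₁ : ℕ) → 3 ≤ p → 0 < r₁ → r₁ < p → Coprime p r₁ → (r Z : ℕ → ℕ) → (t : ℕ) → IsEuclid p r₁ r Z t → (R r (λ _ → 0) t ≡ + 0) × (∀ z → In𝒵 Z t z → Nonzero t z → (+ 0 ℤ.< R r z t) × (R r z t ℤ.< + p))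
lemma3 p r₁ _ _ r₁<p _ r Z t E@(r₀≡p , _ , 1≤t , euclid , rₜ≡1) =
  R-vanishing r (λ _ → 0) t (λ _ _ _ → refl) , bounds
  where
  bounds : ∀ z → In𝒵 Z t z → Nonzero t z → (+ 0 ℤ.< R r z t) × (R r z t ℤ.< + p)
  bounds z (_ , inj₁ z≡0) (i , 1≤i , i≤t , 0<zᵢ) = contradiction (z≡0 i 1≤i i≤t) (ℕ.n>0⇒n≢0 0<zᵢ)
  bounds z (z≤Z , inj₂ (first-odd , zₜ≤Zₜ-1)) z≢0 =
    R-positive first-odd z≢0 , subst (λ q → R r z t ℤ.< + q) r₀≡p (R<r₀ 1≤t)
    where
    open EuclidDigits r Z z t (λ i 1≤i i≤t → proj₁ (euclid i 1≤i i≤t)) z≤Z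
      (subst (0 <_) (sym rₜ≡1) z<s) (last-digit-bound {Z = Z} {z = z} r₁<p E zₜ≤Zₜ-1)
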